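{- Let $\mathcal{G}$ be a hereditary class of graphs and $q\ge 0$ a fixed integer. If $\mathcal{G}$ has a finite set of forbidden induced subgraphs, then so does its $q$-edge-apex class.
   Context: All graphs are simple, finite and undirected. A class of graphs is hereditary if it is closed under taking induced subgraphs; a forbidden induced subgraph for it is a graph not in the class all of whose proper induced subgraphs are in the class. The $q$-edge-apex class of $\mathcal{G}$ is the class of graphs $G$ such that a graph in $\mathcal{G}$ can be obtained from $G$ by deleting at most $q$ edges. -}

module Defs where

open import Data.Nat using (ℕ; _<_; _≤_)
open import Data.Fin using (Fin)
open import Data.Bool using (Bool; true; false)
open import Data.Product using (Σ; _×_; _,_; ∃)
open import Data.Sum using (_⊎_)
open import Data.List using (List; length)
open import Data.List.Relation.Unary.Any using (Any)
open import Data.List.Membership.Propositional using (_∈_)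
open import Relation.Nullary using (¬_)
open import Relation.Binary.PropositionalEquality using (_≡_)
open import Function.Bundles using (_↔_; Inverse)
open import Function.Definitions using (Injective)

record Graph (n : ℕ) : Set where
  field
    adj    : Fin n → Fin n → Bool
    sym    : ∀ i j → adj i j ≡ adj j i
    irrefl : ∀ i → adj i i ≡ false
open Graph public

Class : Set₁
Class = ∀ {n} → Graph n → Set

record Embed {m n : ℕ} (H : Graph m) (G : Graph n) : Set where
  field
    f    : Fin m → Fin n
    inj  : Injective _≡_ _≡_ f
    pres : ∀ i j → adj H i j ≡ adj G (f i) (f j)

Iso : ∀ {m n} → Graph m → Graph n → Set
Iso {m} {n} G H =
  Σ (Fin m ↔ Fin n) λ φ → ∀ i j → adj G i j ≡ adj H (Inverse.to φ i) (Inverse.to φ j)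

Hereditary : Class → Set
Hereditary 𝒢 = ∀ {m n} (H : Graph m) (G : Graph n) → Embed H G → 𝒢 G → 𝒢 H

Forbidden : Class → ∀ {n} → Graph n → Set
Forbidden 𝒢 {n} F =
  ¬ 𝒢 F × (∀ {m} (H : Graph m) → Embed H F → m < n → 𝒢 H)

FinitelyForbidden : Class → Set
FinitelyForbidden 𝒢 =
  Σ (List (Σ ℕ Graph)) λ L →
    ∀ {n} (F : Graph n) → Forbidden 𝒢 F →
      Any (λ (p : Σ ℕ Graph) → Iso F (Data.Product.proj₂ p)) L

DeleteAtMost : ℕ → ∀ {n} → Graph n → Graph n → Set
DeleteAtMost q {n} G G' =
  (∀ i j → adj G' i j ≡ true → adj G i j ≡ true) ×
  Σ (List (Fin n × Fin n)) λ D →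
    length D ≤ q ×
    (∀ i j → adj G i j ≡ true → adj G' i j ≡ false → ((i , j) ∈ D) ⊎ ((j , i) ∈ D))

EdgeApex : ℕ → Class → Class
EdgeApex q 𝒢 {n} G = Σ (Graph n) λ G' → DeleteAtMost q G G' × 𝒢 G'

-- Finitely many forbidden induced subgraphs amounts to a bound k on their order.  Call a vertex
-- set U a q-certificate for G if every deletion of at most q edges from G leaves an induced
-- subgraph outside 𝒢 with all its vertices in U.  If G is not q-edge-apex, it has a q-certificate
-- of size at most apex-bound k q: take a forbidden induced subgraph H of G; a deletion of at most
-- q edges either leaves H intact, or deletes a pair xy of H and is then a deletion of at most
-- q - 1 edges from G - xy, for which induction gives a certificate U_xy; the vertices of H
-- together with all U_xy form the certificate.  A forbidden graph F of the q-edge-apex class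
-- cannot have a vertex v outside its certificate: F - v is q-edge-apex, and lifting its edge
-- deletion to F leaves every induced subgraph on F - v, in particular those inside the
-- certificate, in 𝒢.  Hence F has at most apex-bound k q vertices, and graphs of bounded order
-- are finitely many up to isomorphism.
-- Membership in 𝒢 is not decidable, so forbidden subgraphs are found under double negation; this
-- is harmless because the resulting bound on the order is decidable.
module Submission where

open import Defs
open import Level using (0ℓ)
open import Data.Nat using (ℕ; zero; suc; _+_; _*_; _≤_; _<_; z≤n; s≤s)
import Data.Nat.Properties as ℕ
open import Data.Bool using (Bool; true; false; if_then_else_; _∧_)
open import Data.Bool.Properties as Bool using (∧-comm; ∧-idem)
open import Data.Fin using (Fin; zero; suc; punchIn; punchOut; _≟_)
open import Data.Fin.Properties using (punchIn-injective; punchIn-punchOut; injective⇒≤; ¬∀⟶∃¬; all?; any?)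
open import Data.Fin.Permutation using (↔⇒≡)
open import Data.Product as Product using (Σ; ∃; _×_; _,_; proj₁; proj₂)
open import Data.Product.Properties using (≡-dec; ,-injective)
open import Data.Sum as Sum using (_⊎_; inj₁; inj₂; [_,_]′)
open import Data.Vec as Vec using (Vec; []; _∷_)
open import Data.Vec.Properties using (lookup∘tabulate)
open import Data.List as List using (List; []; _∷_; [_]; _++_; length; tabulate; lookup; filter)
open import Data.List.Properties using (length-tabulate; length-filter; length-++; length-map)
open import Data.List.Extrema.Nat using (max; v≤max⁺)
open import Data.List.Relation.Unary.Any as Any using (Any; here; there; index)
open import Data.List.Relation.Unary.Any.Properties using (lookup-index; map⁺; map⁻; concat⁺; applyUpTo⁺)
open import Data.List.Membership.Propositional using (_∈_; _∉_)
open import Data.List.Membership.Propositional.Properties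
  using ( ∈-tabulate⁺; ∈-concat⁺′; ∈-cartesianProductWith⁺; ∈-∃++; ∈-++⁺ˡ; ∈-++⁺ʳ; ∈-++⁻; ∈-map⁺
        ; ∈-filter⁺; ∈-filter⁻)
open import Data.List.Relation.Binary.Subset.Propositional using (_⊆_)
open import Data.List.Relation.Binary.Permutation.Propositional using (_↭_; ↭-sym)
open import Data.List.Relation.Binary.Permutation.Propositional.Properties using (∈-resp-↭; shift; ↭-length)
open import Effect.Monad using (RawMonad)
open import Function.Base using (case_of_; _∘_)
open import Function.Bundles using (_⇔_; mk⇔)
open import Function.Construct.Identity using (↔-id)
open import Function.Definitions using (Injective)
open import Relation.Nullary using (¬_; Dec; yes; no; does)
open import Relation.Nullary.Decidable using (_⊎-dec_; dec-true; dec-false; does-⇔; ¬¬-excluded-middle)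
open import Relation.Nullary.Negation using (DoubleNegation; ¬¬-Monad; contradiction)
open import Relation.Binary.PropositionalEquality
  using (_≡_; _≢_; refl; cong; cong₂; subst; module ≡-Reasoning) renaming (sym to ≡-sym; trans to ≡-trans)

open RawMonad (¬¬-Monad {0ℓ}) using (_>>=_; pure; _<$>_)

private
  variable
    m n : ℕ

¬¬-∀-Fin : {P : Fin n → Set} → (∀ i → DoubleNegation (P i)) → DoubleNegation (∀ i → P i)
¬¬-∀-Fin {zero} _ = pure λ ()
¬¬-∀-Fin {suc n} ¬¬P = do
  p₀ ← ¬¬P zero
  ps ← ¬¬-∀-Fin (λ i → ¬¬P (suc i))
  pure λ { zero → p₀ ; (suc i) → ps i }

missing-vertex : (U : List (Fin n)) → length U < n → ∃ λ v → v ∉ U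
missing-vertex {n} U |U|<n = ¬∀⟶∃¬ n (_∈ U) (λ v → Any.any? (v ≟_) U) covers⇏
  where
  covers⇏ : ¬ (∀ v → v ∈ U)
  covers⇏ covers = ℕ.<⇒≱ |U|<n (injective⇒≤ index-injective)
    where
    index-injective : Injective _≡_ _≡_ (λ v → index (covers v))
    index-injective {v} {w} eq =
      ≡-trans (lookup-index (covers v)) (≡-trans (cong (lookup U) eq) (≡-sym (lookup-index (covers w))))

infix 4 _≈_
_≈_ : Graph n → Graph n → Set
G ≈ H = ∀ i j → adj G i j ≡ adj H i j

≈-sym : {G H : Graph n} → G ≈ H → H ≈ G
≈-sym G≈H i j = ≡-sym (G≈H i j)

induced : Graph n → (Fin m → Fin n) → Graph m
induced G g = record
  { adj = λ i j → adj G (g i) (g j)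
  ; sym = λ i j → sym G (g i) (g j)
  ; irrefl = λ i → irrefl G (g i) }

_-_ : Graph (suc n) → Fin (suc n) → Graph n
G - v = induced G (punchIn v)

vertex-deleted-embed : (G : Graph (suc n)) (v : Fin (suc n)) → Embed (G - v) G
vertex-deleted-embed G v = record { f = punchIn v ; inj = punchIn-injective v _ _ ; pres = λ _ _ → refl }

≈⇒Embed : {G H : Graph n} → G ≈ H → Embed G H
≈⇒Embed G≈H = record { f = λ i → i ; inj = λ eq → eq ; pres = G≈H }

Embed-refl : {G : Graph n} → Embed G G
Embed-refl = ≈⇒Embed (λ _ _ → refl)

Embed-trans : {H : Graph m} {G : Graph n} {l : ℕ} {K : Graph l} → Embed H G → Embed G K → Embed H K
Embed-trans e e′ = record
  { f = λ i → Embed.f e′ (Embed.f e i)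
  ; inj = λ eq → Embed.inj e (Embed.inj e′ eq)
  ; pres = λ i j → ≡-trans (Embed.pres e i j) (Embed.pres e′ _ _) }

Embed-avoiding : {H : Graph m} {G : Graph (suc n)} {v : Fin (suc n)} (e : Embed H G) →
                 (∀ i → Embed.f e i ≢ v) → Embed H (G - v)
Embed-avoiding {G = G} {v} e avoids = record
  { f = λ i → punchOut (v≢ i)
  ; inj = λ {i} {j} eq → Embed.inj e (≡-trans (≡-sym (punchIn-punchOut (v≢ i)))
                                      (≡-trans (cong (punchIn v) eq) (punchIn-punchOut (v≢ j))))
  ; pres = λ i j → ≡-trans (Embed.pres e i j)
                     (≡-sym (cong₂ (adj G) (punchIn-punchOut (v≢ i)) (punchIn-punchOut (v≢ j)))) }
  where
  v≢ : ∀ i → v ≢ Embed.f e i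
  v≢ i eq = avoids i (≡-sym eq)

Embed-vertex-deleted : {H : Graph m} {G : Graph (suc n)} → Embed H G → m < suc n → ∃ λ v → Embed H (G - v)
Embed-vertex-deleted e m<n =
  let v , v∉image = missing-vertex (tabulate (Embed.f e)) (subst (_< _) (≡-sym (length-tabulate _)) m<n)
  in v , Embed-avoiding e (λ i fi≡v → v∉image (subst (_∈ _) fi≡v (∈-tabulate⁺ i)))

Pairs : ℕ → Set
Pairs n = List (Fin n × Fin n)

Removes : Pairs n → Fin n → Fin n → Set
Removes D i j = (i , j) ∈ D ⊎ (j , i) ∈ D

removes? : (D : Pairs n) (i j : Fin n) → Dec (Removes D i j)
removes? D i j = Any.any? ((i , j) ≟ₚ_) D ⊎-dec Any.any? ((j , i) ≟ₚ_) D
  where _≟ₚ_ = ≡-dec _≟_ _≟_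

Removes-sym : {D : Pairs n} {i j : Fin n} → Removes D i j ⇔ Removes D j i
Removes-sym = mk⇔ Sum.swap Sum.swap

infixl 6 _∖_
_∖_ : Graph n → Pairs n → Graph n
G ∖ D = record
  { adj = λ i j → if does (removes? D i j) then false else adj G i j
  ; sym = λ i j → cong₂ (if_then false else_) (does-⇔ Removes-sym (removes? D i j) (removes? D j i)) (sym G i j)
  ; irrefl = λ i → if-false (does (removes? D i i)) (irrefl G i) }
  where
  if-false : ∀ b {x} → x ≡ false → (if b then false else x) ≡ false
  if-false true  _ = refl
  if-false false x≡false = x≡false

∖-removed : (G : Graph n) {D : Pairs n} {i j : Fin n} → Removes D i j → adj (G ∖ D) i j ≡ false
∖-removed G {D} {i} {j} r = cong (if_then false else adj G i j) (dec-true (removes? D i j) r)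

∖-unremoved : (G : Graph n) {D : Pairs n} {i j : Fin n} → ¬ Removes D i j → adj (G ∖ D) i j ≡ adj G i j
∖-unremoved G {D} {i} {j} ¬r = cong (if_then false else adj G i j) (dec-false (removes? D i j) ¬r)

∖-adj-cong : (G : Graph n) {D D′ : Pairs n} {i j : Fin n} →
             Removes D i j ⇔ Removes D′ i j → adj (G ∖ D) i j ≡ adj (G ∖ D′) i j
∖-adj-cong G {D} {D′} {i} {j} D⇔D′ =
  cong (if_then false else adj G i j) (does-⇔ D⇔D′ (removes? D i j) (removes? D′ i j))

∖-resp-↭ : (G : Graph n) {D D′ : Pairs n} → D ↭ D′ → G ∖ D ≈ G ∖ D′
∖-resp-↭ G D↭D′ i j = ∖-adj-cong G (mk⇔ (Sum.map (∈-resp-↭ D↭D′) (∈-resp-↭ D↭D′))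
                               (Sum.map (∈-resp-↭ (↭-sym D↭D′)) (∈-resp-↭ (↭-sym D↭D′))))

∖-∖ : (G : Graph n) (D₁ D₂ : Pairs n) → G ∖ (D₁ ++ D₂) ≈ G ∖ D₁ ∖ D₂
∖-∖ G D₁ D₂ i j with removes? D₂ i j
... | yes r₂ = ≡-trans (∖-removed G (Sum.map (∈-++⁺ʳ D₁) (∈-++⁺ʳ D₁) r₂))
                      (≡-sym (∖-removed (G ∖ D₁) r₂))
... | no ¬r₂ = ≡-trans (∖-adj-cong G (mk⇔ only-D₁ (Sum.map ∈-++⁺ˡ ∈-++⁺ˡ)))
                      (≡-sym (∖-unremoved (G ∖ D₁) ¬r₂))
  where
  only-D₁ : Removes (D₁ ++ D₂) i j → Removes D₁ i j
  only-D₁ (inj₁ p) = [ inj₁ , (λ p₂ → contradiction (inj₁ p₂) ¬r₂) ]′ (∈-++⁻ D₁ p)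
  only-D₁ (inj₂ p) = [ inj₂ , (λ p₂ → contradiction (inj₂ p₂) ¬r₂) ]′ (∈-++⁻ D₁ p)

∖-DeleteAtMost : (G : Graph n) (D : Pairs n) {q : ℕ} → length D ≤ q → DeleteAtMost q G (G ∖ D)
∖-DeleteAtMost G D |D|≤q = spanning , D , |D|≤q , covered
  where
  spanning : ∀ i j → adj (G ∖ D) i j ≡ true → adj G i j ≡ true
  spanning i j e with removes? D i j
  ... | yes r = contradiction (≡-trans (≡-sym e) (∖-removed G r)) λ ()
  ... | no ¬r = ≡-trans (≡-sym (∖-unremoved G ¬r)) e
  covered : ∀ i j → adj G i j ≡ true → adj (G ∖ D) i j ≡ false → Removes D i j
  covered i j e e′ with removes? D i j
  ... | yes r = r
  ... | no ¬r = contradiction (≡-trans (≡-sym e) (≡-trans (≡-sym (∖-unremoved G ¬r)) e′)) λ ()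

DeleteAtMost⇒∖ : {q : ℕ} {G G′ : Graph n} → DeleteAtMost q G G′ →
                 ∃ λ D → length D ≤ q × G ∖ D ≈ G′
DeleteAtMost⇒∖ {G = G} {G′} (spanning , D , |D|≤q , covered) =
  D′ , ℕ.≤-trans (length-filter missing? D) |D|≤q , agree
  where
  missing? : (p : Fin _ × Fin _) → Dec (adj G′ (proj₁ p) (proj₂ p) ≡ false)
  missing? (i , j) = adj G′ i j Bool.≟ false
  -- D may also list pairs that are still edges of G′.
  D′ = filter missing? D
  agree : G ∖ D′ ≈ G′
  agree i j with removes? D′ i j
  ... | yes r = ≡-trans (∖-removed G r) (≡-sym (removed-missing r))
    where
    removed-missing : Removes D′ i j → adj G′ i j ≡ false
    removed-missing (inj₁ p) = proj₂ (∈-filter⁻ missing? {xs = D} p)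
    removed-missing (inj₂ p) = ≡-trans (sym G′ i j) (proj₂ (∈-filter⁻ missing? {xs = D} p))
  ... | no ¬r = ≡-trans (∖-unremoved G ¬r) kept
    where
    kept : adj G i j ≡ adj G′ i j
    kept with adj G i j in e | adj G′ i j in e′
    ... | true  | true  = refl
    ... | false | false = refl
    ... | false | true  = contradiction (≡-trans (≡-sym (spanning i j e′)) e) λ ()
    ... | true  | false = contradiction (Sum.map (λ p → ∈-filter⁺ missing? p e′)
                                                 (λ p → ∈-filter⁺ missing? p (≡-trans (sym G′ j i) e′))
                                                 (covered i j e e′)) ¬r

induced-∖ : (G : Graph n) {g : Fin m → Fin n} → Injective _≡_ _≡_ g → (D : Pairs m) →
            induced (G ∖ List.map (Product.map g g) D) g ≈ induced G g ∖ D
induced-∖ G {g} g-inj D a b = cong (if_then false else adj G (g a) (g b))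
  (does-⇔ (mk⇔ (Sum.map pullback pullback) (Sum.map (∈-map⁺ g×g) (∈-map⁺ g×g)))
          (removes? (List.map g×g D) (g a) (g b)) (removes? D a b))
  where
  g×g = Product.map g g
  pullback : ∀ {x y} → (g x , g y) ∈ List.map g×g D → (x , y) ∈ D
  pullback p = Any.map (λ eq → let gx≡ , gy≡ = ,-injective eq in cong₂ _,_ (g-inj gx≡) (g-inj gy≡)) (map⁻ p)

⋃ : {A : Set} → (Fin m → List A) → List A
⋃ h = List.concat (tabulate h)

∈-⋃ : {A : Set} (h : Fin m → List A) (i : Fin m) {x : A} → x ∈ h i → x ∈ ⋃ h
∈-⋃ h i x∈ = ∈-concat⁺′ x∈ (∈-tabulate⁺ i)

length-⋃-≤ : {A : Set} {c : ℕ} (h : Fin m → List A) → (∀ i → length (h i) ≤ c) → length (⋃ h) ≤ m * c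
length-⋃-≤ {zero}  h bounded = z≤n
length-⋃-≤ {suc m} h bounded = ℕ.≤-trans (ℕ.≤-reflexive (length-++ (h zero)))
  (ℕ.+-mono-≤ (bounded zero) (length-⋃-≤ (λ i → h (suc i)) (λ i → bounded (suc i))))

ForbiddenOrderAtMost : ℕ → Class → Set
ForbiddenOrderAtMost k 𝒢 = ∀ {m} (H : Graph m) → Forbidden 𝒢 H → m ≤ k

-- A forbidden subgraph (order at most k) plus a certificate for each of its at most k² vertex pairs.
apex-bound : ℕ → ℕ → ℕ
apex-bound k zero    = k
apex-bound k (suc q) = k + k * (k * apex-bound k q)

module _ (𝒢 : Class) (hereditary : Hereditary 𝒢) where

  record ForbiddenSubgraph (G : Graph n) : Set where
    field
      {order}   : ℕ
      graph     : Graph order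
      embedding : Embed graph G
      forbidden : Forbidden 𝒢 graph

  ForbiddenSubgraph-lift : {G : Graph m} {K : Graph n} → Embed G K → ForbiddenSubgraph G → ForbiddenSubgraph K
  ForbiddenSubgraph-lift e F = record { graph = graph ; embedding = Embed-trans embedding e ; forbidden = forbidden }
    where open ForbiddenSubgraph F

  vertex-minimal⇒Forbidden : (G : Graph (suc n)) → ¬ 𝒢 G → (∀ v → 𝒢 (G - v)) → Forbidden 𝒢 G
  vertex-minimal⇒Forbidden G G∉ deletions∈ = G∉ , λ H e m<n →
    let v , e′ = Embed-vertex-deleted e m<n in hereditary H (G - v) e′ (deletions∈ v)

  forbidden-subgraph : (G : Graph n) → ¬ 𝒢 G → DoubleNegation (ForbiddenSubgraph G)
  forbidden-subgraph {zero} G G∉ = pure record { graph = G ; embedding = Embed-refl ; forbidden = G∉ , λ _ _ () }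
  forbidden-subgraph {suc n} G G∉ = do
    decide ← ¬¬-∀-Fin (λ v → ¬¬-excluded-middle {A = 𝒢 (G - v)})
    case all? decide of λ where
      (yes deletions∈) → pure record
        { graph = G ; embedding = Embed-refl ; forbidden = vertex-minimal⇒Forbidden G G∉ deletions∈ }
      (no ¬deletions∈) →
        let v , G-v∉ = ¬∀⟶∃¬ _ _ decide ¬deletions∈
        in ForbiddenSubgraph-lift (vertex-deleted-embed G v) <$> forbidden-subgraph (G - v) G-v∉

  EdgeApex⇒∖ : {q : ℕ} {G : Graph n} → EdgeApex q 𝒢 G → ∃ λ D → length D ≤ q × 𝒢 (G ∖ D)
  EdgeApex⇒∖ {G = G} (G′ , deletion , G′∈) =
    let D , |D|≤q , G∖D≈G′ = DeleteAtMost⇒∖ {G = G} {G′ = G′} deletion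
    in D , |D|≤q , hereditary (G ∖ D) G′ (≈⇒Embed G∖D≈G′) G′∈

  ∖⇒EdgeApex : {q : ℕ} (G : Graph n) (D : Pairs n) → length D ≤ q → 𝒢 (G ∖ D) → EdgeApex q 𝒢 G
  ∖⇒EdgeApex G D |D|≤q G∖D∈ = G ∖ D , ∖-DeleteAtMost G D |D|≤q , G∖D∈

  ⊆EdgeApex : {q : ℕ} {G : Graph n} → 𝒢 G → EdgeApex q 𝒢 G
  ⊆EdgeApex {G = G} G∈ = ∖⇒EdgeApex G [] z≤n (hereditary _ G (≈⇒Embed (λ _ _ → refl)) G∈)

  EdgeApex-∖ : {q : ℕ} (G : Graph n) (x : Fin n × Fin n) → EdgeApex q 𝒢 (G ∖ [ x ]) → EdgeApex (suc q) 𝒢 G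
  EdgeApex-∖ G x apex =
    let D , |D|≤q , G∖x∖D∈ = EdgeApex⇒∖ {G = G ∖ [ x ]} apex
    in ∖⇒EdgeApex G (x ∷ D) (s≤s |D|≤q) (hereditary _ _ (≈⇒Embed (∖-∖ G [ x ] D)) G∖x∖D∈)

  record Obstruction (G : Graph n) (U : List (Fin n)) : Set where
    field
      {order}   : ℕ
      graph     : Graph order
      embedding : Embed graph G
      inside    : ∀ i → Embed.f embedding i ∈ U
      outside   : ¬ 𝒢 graph

  Obstruction-≈ : {G G′ : Graph n} {U : List (Fin n)} → G ≈ G′ → Obstruction G U → Obstruction G′ U
  Obstruction-≈ G≈G′ O = record
    { graph = graph ; embedding = Embed-trans embedding (≈⇒Embed G≈G′) ; inside = inside ; outside = outside }
    where open Obstruction O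

  Obstruction-⊆ : {G : Graph n} {U U′ : List (Fin n)} → U ⊆ U′ → Obstruction G U → Obstruction G U′
  Obstruction-⊆ U⊆U′ O = record
    { graph = graph ; embedding = embedding ; inside = λ i → U⊆U′ (inside i) ; outside = outside }
    where open Obstruction O

  Certificate : ℕ → Graph n → List (Fin n) → Set
  Certificate q G U = ∀ D → length D ≤ q → Obstruction (G ∖ D) U

  untouched-Obstruction : {G : Graph n} {D : Pairs n} (F : ForbiddenSubgraph G) →
    let f = Embed.f (ForbiddenSubgraph.embedding F) in
    (∀ a b → ¬ Removes D (f a) (f b)) → Obstruction (G ∖ D) (tabulate f)
  untouched-Obstruction {G = G} F untouched = record
    { graph = graph
    ; embedding = record
      { f = f ; inj = inj ; pres = λ a b → ≡-trans (pres a b) (≡-sym (∖-unremoved G (untouched a b))) }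
    ; inside = ∈-tabulate⁺
    ; outside = proj₁ forbidden }
    where
    open ForbiddenSubgraph F
    open Embed embedding

  Certificate-∖-member : {q : ℕ} {G : Graph n} {U : List (Fin n)} {x : Fin n × Fin n} {D : Pairs n} →
                         Certificate q (G ∖ [ x ]) U → x ∈ D → length D ≤ suc q → Obstruction (G ∖ D) U
  Certificate-∖-member {q = q} {G} {U} {x} certificate x∈D |D|≤1+q with ∈-∃++ x∈D
  ... | ys , zs , refl =
    Obstruction-≈ (∖-resp-↭ G (↭-sym D↭)) obstruction
    where
    D′ = ys ++ zs
    D↭ : ys ++ [ x ] ++ zs ↭ x ∷ D′
    D↭ = shift x ys zs
    |D′|≤q : length D′ ≤ q
    |D′|≤q = ℕ.≤-pred (subst (_≤ suc q) (↭-length D↭) |D|≤1+q)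
    obstruction : Obstruction (G ∖ (x ∷ D′)) U
    obstruction = Obstruction-≈ (≈-sym {G = G ∖ (x ∷ D′)} {H = G ∖ [ x ] ∖ D′} (∖-∖ G [ x ] D′))
                                (certificate D′ |D′|≤q)

  Forbidden⇒Certificate-covers : {q : ℕ} {F : Graph (suc n)} {U : List (Fin (suc n))} →
    Forbidden (EdgeApex q 𝒢) F → Certificate q F U → ∀ v → ¬ v ∉ U
  Forbidden⇒Certificate-covers {q = q} {F} {U} (_ , proper∈) certificate v v∉U =
    outside (hereditary graph (F - v ∖ D) (Embed-trans (Embed-avoiding embedding avoids) (≈⇒Embed F∖D-v≈F-v∖D))
                        F-v∖D∈)
    where
    apex = EdgeApex⇒∖ (proper∈ (F - v) (vertex-deleted-embed F v) ℕ.≤-refl)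
    D = proj₁ apex
    F-v∖D∈ = proj₂ (proj₂ apex)
    F∖D-v≈F-v∖D = induced-∖ F (punchIn-injective v _ _) D
    open Obstruction (certificate (List.map (Product.map (punchIn v) (punchIn v)) D)
                                  (subst (_≤ q) (≡-sym (length-map _ D)) (proj₁ (proj₂ apex))))
    avoids : ∀ i → Embed.f embedding i ≢ v
    avoids i eq = v∉U (subst (_∈ U) eq (inside i))

  module _ {k : ℕ} (order≤k : ForbiddenOrderAtMost k 𝒢) where

    Certified : ℕ → Graph n → Set
    Certified {n} q G = ∃ λ (U : List (Fin n)) → length U ≤ apex-bound k q × Certificate q G U

    certified-base : {G : Graph n} → ForbiddenSubgraph G → Certified zero G
    certified-base F = tabulate f , subst (_≤ k) (≡-sym (length-tabulate f)) (order≤k graph forbidden) , certify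
      where
      open ForbiddenSubgraph F
      f = Embed.f embedding
      certify : Certificate zero _ (tabulate f)
      certify [] _ = untouched-Obstruction {D = []} F λ _ _ → λ { (inj₁ ()) ; (inj₂ ()) }

    certified-step : {q : ℕ} {G : Graph n} (F : ForbiddenSubgraph G) →
      let f = Embed.f (ForbiddenSubgraph.embedding F) in
      (∀ a b → Certified q (G ∖ [ (f a , f b) ])) → Certified (suc q) G
    certified-step {q = q} {G} F sub = W ++ V , |W++V|≤ , certify
      where
      open ForbiddenSubgraph F
      f = Embed.f embedding
      m≤k = order≤k graph forbidden
      W = tabulate f
      U : ∀ a b → List (Fin _)
      U a b = proj₁ (sub a b)
      certificate : ∀ a b → Certificate q (G ∖ [ (f a , f b) ]) (U a b)
      certificate a b = proj₂ (proj₂ (sub a b))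
      V = ⋃ λ a → ⋃ λ b → U a b
      |V|≤ : length V ≤ order * (order * apex-bound k q)
      |V|≤ = length-⋃-≤ _ λ a → length-⋃-≤ _ λ b → proj₁ (proj₂ (sub a b))
      |W++V|≤ : length (W ++ V) ≤ apex-bound k (suc q)
      |W++V|≤ = begin
        length (W ++ V)                          ≡⟨ length-++ W ⟩
        length W + length V                      ≡⟨ cong (_+ length V) (length-tabulate f) ⟩
        order + length V                         ≤⟨ ℕ.+-monoʳ-≤ order |V|≤ ⟩
        order + order * (order * apex-bound k q) ≤⟨ ℕ.+-mono-≤ m≤k (ℕ.*-mono-≤ m≤k (ℕ.*-monoˡ-≤ _ m≤k)) ⟩
        k + k * (k * apex-bound k q)             ∎
        where open ℕ.≤-Reasoning
      into-V : ∀ a b → U a b ⊆ W ++ V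
      into-V a b v∈ = ∈-++⁺ʳ W (∈-⋃ _ a (∈-⋃ _ b v∈))
      certify : Certificate (suc q) G (W ++ V)
      certify D |D|≤ with any? (λ a → any? (λ b → removes? D (f a) (f b)))
      ... | yes (a , b , inj₁ fab∈D) = Obstruction-⊆ (into-V a b) (Certificate-∖-member (certificate a b) fab∈D |D|≤)
      ... | yes (a , b , inj₂ fba∈D) = Obstruction-⊆ (into-V b a) (Certificate-∖-member (certificate b a) fba∈D |D|≤)
      ... | no untouched = Obstruction-⊆ ∈-++⁺ˡ (untouched-Obstruction F λ a b r → untouched (a , b , r))

    certified : ∀ q (G : Graph n) → ¬ EdgeApex q 𝒢 G → DoubleNegation (Certified q G)
    certified zero G G∉ = certified-base <$> forbidden-subgraph G (G∉ ∘ ⊆EdgeApex)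
    certified (suc q) G G∉ = do
      F ← forbidden-subgraph G (G∉ ∘ ⊆EdgeApex)
      let f = Embed.f (ForbiddenSubgraph.embedding F)
      sub ← ¬¬-∀-Fin λ a → ¬¬-∀-Fin λ b →
               certified q (G ∖ [ (f a , f b) ]) (G∉ ∘ EdgeApex-∖ G (f a , f b))
      pure (certified-step F sub)

    EdgeApex-ForbiddenOrderAtMost : ∀ q → ForbiddenOrderAtMost (apex-bound k q) (EdgeApex q 𝒢)
    EdgeApex-ForbiddenOrderAtMost q F forbidden = ℕ.≮⇒≥ (large⇏ F forbidden)
      where
      large⇏ : (F : Graph n) → Forbidden (EdgeApex q 𝒢) F → ¬ apex-bound k q < n
      large⇏ {zero} _ _ ()
      large⇏ {suc n} F forbidden bound<n = certified q F (proj₁ forbidden) λ (U , |U|≤ , certificate) →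
        let v , v∉U = missing-vertex U (ℕ.≤-<-trans |U|≤ bound<n)
        in Forbidden⇒Certificate-covers forbidden certificate v v∉U

allVecs : {A : Set} → List A → (n : ℕ) → List (Vec A n)
allVecs xs zero    = [ [] ]
allVecs xs (suc n) = List.cartesianProductWith _∷_ xs (allVecs xs n)

∈-allVecs : {A : Set} {xs : List A} → (∀ x → x ∈ xs) → (v : Vec A n) → v ∈ allVecs xs n
∈-allVecs all∈ []      = here refl
∈-allVecs all∈ (x ∷ v) = ∈-cartesianProductWith⁺ _∷_ (all∈ x) (∈-allVecs all∈ v)

∈-bools : ∀ b → b ∈ true ∷ false ∷ []
∈-bools true  = here refl
∈-bools false = there (here refl)

fromMatrix : Vec (Vec Bool n) n → Graph n
fromMatrix M = record
  { adj = λ i j → if does (i ≟ j) then false else entry i j ∧ entry j i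
  ; sym = λ i j → cong₂ (if_then false else_) (does-⇔ (mk⇔ ≡-sym ≡-sym) (i ≟ j) (j ≟ i))
                                              (∧-comm (entry i j) _)
  ; irrefl = λ i → cong (if_then false else entry i i ∧ entry i i) (dec-true (i ≟ i) refl) }
  where
  entry : Fin _ → Fin _ → Bool
  entry i j = Vec.lookup (Vec.lookup M i) j

toMatrix : Graph n → Vec (Vec Bool n) n
toMatrix G = Vec.tabulate λ i → Vec.tabulate (adj G i)

fromMatrix∘toMatrix : (G : Graph n) → G ≈ fromMatrix (toMatrix G)
fromMatrix∘toMatrix G i j with i ≟ j
... | yes refl = irrefl G i
... | no _ = begin
  adj G i j               ≡⟨ ∧-idem (adj G i j) ⟨
  adj G i j ∧ adj G i j   ≡⟨ cong₂ _∧_ (entry≡adj i j) (≡-trans (entry≡adj j i) (sym G j i)) ⟨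
  entry i j ∧ entry j i   ∎
  where
  open ≡-Reasoning
  entry : Fin _ → Fin _ → Bool
  entry i j = Vec.lookup (Vec.lookup (toMatrix G) i) j
  entry≡adj : ∀ i j → entry i j ≡ adj G i j
  entry≡adj i j = ≡-trans (cong (λ row → Vec.lookup row j) (lookup∘tabulate _ i)) (lookup∘tabulate _ j)

graphs-of-order : ℕ → List (Σ ℕ Graph)
graphs-of-order n = List.map (λ M → n , fromMatrix M) (allVecs (allVecs (true ∷ false ∷ []) n) n)

graphs-of-order-complete : (G : Graph n) → Any (λ p → Iso G (proj₂ p)) (graphs-of-order n)
graphs-of-order-complete G =
  map⁺ (Any.map (λ { refl → G≅ }) (∈-allVecs (∈-allVecs ∈-bools) (toMatrix G)))
  where
  G≅ : Iso G (fromMatrix (toMatrix G))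
  G≅ = ↔-id _ , fromMatrix∘toMatrix G

graphs-of-order-≤ : ℕ → List (Σ ℕ Graph)
graphs-of-order-≤ N = List.concat (List.applyUpTo graphs-of-order (suc N))

graphs-of-order-≤-complete : {N : ℕ} (G : Graph n) → n ≤ N →
                             Any (λ p → Iso G (proj₂ p)) (graphs-of-order-≤ N)
graphs-of-order-≤-complete G n≤N = concat⁺ (applyUpTo⁺ graphs-of-order (graphs-of-order-complete G) (s≤s n≤N))

ForbiddenOrderAtMost⇒FinitelyForbidden : {k : ℕ} {𝒢 : Class} → ForbiddenOrderAtMost k 𝒢 → FinitelyForbidden 𝒢
ForbiddenOrderAtMost⇒FinitelyForbidden {k} order≤k =
  graphs-of-order-≤ k , λ F forbidden → graphs-of-order-≤-complete F (order≤k F forbidden)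

FinitelyForbidden⇒ForbiddenOrderAtMost : {𝒢 : Class} → FinitelyForbidden 𝒢 → ∃ λ k → ForbiddenOrderAtMost k 𝒢
FinitelyForbidden⇒ForbiddenOrderAtMost (L , covers) = max 0 (List.map proj₁ L) , λ H forbidden →
  v≤max⁺ 0 _ (inj₂ (map⁺ (Any.map (λ iso → ℕ.≤-reflexive (↔⇒≡ (proj₁ iso))) (covers H forbidden))))

corollary2p9 : (𝒢 : Class) (q : ℕ) → Hereditary 𝒢 → FinitelyForbidden 𝒢 →
    FinitelyForbidden (EdgeApex q 𝒢)
corollary2p9 𝒢 q hereditary finite =
  let k , order≤k = FinitelyForbidden⇒ForbiddenOrderAtMost finite
  in ForbiddenOrderAtMost⇒FinitelyForbidden (EdgeApex-ForbiddenOrderAtMost 𝒢 hereditary order≤k q)
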